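{- Let $N,k$ be non-negative integers and $l$ a positive integer, and let $Q_{k,l}(m,n)=(m+n)l+k\frac{n(n-1)}{2}+(n-1)mk+(k+1)\frac{m(m+1)}{2}$. Then \begin{align*} \sum_{j\geq 0}x^jq^{lj+kj(j-1)/2}{N-l-(j-1)k+j \brack j}_q =\sum_{m,n\geq 0}x^{m+n}q^{Q_{k,l}(m,n)}{N-(l+(n-1)k+m(k+1))+m \brack m}_q{N-(l+(n-1)k)-km+\lfloor n/2\rfloor \brack \lfloor n/2\rfloor}_{q^2}. \end{align*}
   Context: For integers $A,B$ and base $p$, ${A\brack B}_p=\frac{(p;p)_A}{(p;p)_B(p;p)_{A-B}}$ if $0\le B\le A$ and $0$ otherwise, where $(a;p)_j=\prod_{i=0}^{j-1}(1-ap^i)$. $\lfloor\cdot\rfloor$ is the floor function. Both sides are regarded as formal power series in $x,q$. -}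

module Defs where

open import Data.Nat as ℕ using (ℕ; zero; suc; _∸_; _≤ᵇ_; _≡ᵇ_)
open import Data.Integer as ℤ using (ℤ; +_; -_; ∣_∣)
open import Data.Bool using (if_then_else_)
open import Relation.Nullary.Decidable using (does)

-- Formal power series in q with integer coefficients: n ↦ coefficient of q^n.
PS : Set
PS = ℕ → ℤ

-- Formal power series in x and q: s ↦ (coefficient of x^s, itself a series in q).
PS2 : Set
PS2 = ℕ → PS

sumTo : ℕ → (ℕ → ℤ) → ℤ
sumTo zero    f = f 0
sumTo (suc n) f = sumTo n f ℤ.+ f (suc n)

zeroS : PS
zeroS _ = + 0

oneS : PS
oneS zero    = + 1
oneS (suc _) = + 0

mono : ℕ → PS
mono e d = if d ≡ᵇ e then + 1 else + 0

-- monomial q^Q for an integer exponent Q (only ever used with Q ≥ 0)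
monoℤ : ℤ → PS
monoℤ Q d = if does (+ d ℤ.≟ Q) then + 1 else + 0

_-ₛ_ : PS → PS → PS
(f -ₛ g) n = f n ℤ.- g n

_·_ : PS → PS → PS
(f · g) n = sumTo n (λ i → f i ℤ.* g (n ∸ i))

infixl 7 _·_

-- Multiplicative inverse of a power series whose constant term is 1:
-- b₀ = 1, b_{n+1} = - Σ_{t=0}^{n} f_{n+1-t} b_t.
-- invUpTo f n is correct on indices ≤ n.
invUpTo : PS → ℕ → PS
invUpTo f zero    = λ _ → + 1
invUpTo f (suc n) = λ i → if i ≤ᵇ n then b i
                          else ℤ.- sumTo n (λ t → f (suc n ∸ t) ℤ.* b t)
  where b = invUpTo f n

inv1 : PS → PS
inv1 f n = invUpTo f n n

-- q-Pochhammer (p;p)_j = ∏_{i=0}^{j-1} (1 - p^{i+1}) with base p = q^e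
poch : (e : ℕ) → ℕ → PS
poch e zero    = oneS
poch e (suc j) = poch e j · (oneS -ₛ mono (e ℕ.* suc j))

qbin : (e : ℕ) → ℤ → ℕ → PS
qbin e A B = if does (+ B ℤ.≤? A)
             then poch e ∣ A ∣ · inv1 (poch e B) · inv1 (poch e (∣ A ∣ ∸ B))
             else zeroS

-- Σ_{j ≥ 0} x^j f_j  (summable family; coefficient of x^s is f_s)
xSum : (ℕ → PS) → PS2
xSum f s = f s

-- Σ_{m,n ≥ 0} x^{m+n} g_{m,n}  (coefficient of x^s is Σ_{m+n=s} g_{m,n})
xSum2 : (ℕ → ℕ → PS) → PS2
xSum2 g s d = sumTo s (λ m → g m (s ∸ m) d)

Qkl : ℕ → ℕ → ℕ → ℕ → ℤ
Qkl k l m n =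
  + ((m ℕ.+ n) ℕ.* l) ℤ.+ + (k ℕ.* ((n ℕ.* (n ∸ 1)) ℕ./ 2))
  ℤ.+ ((+ n ℤ.- + 1) ℤ.* + m ℤ.* + k)
  ℤ.+ + ((k ℕ.+ 1) ℕ.* ((m ℕ.* (m ℕ.+ 1)) ℕ./ 2))

module Submission where

-- Writing Z = N - l - (s-1)k and using Q_{k,l}(m,n) = ls + k s(s-1)/2 + m(m+1)/2
-- for m + n = s, this is the convolution identity
--   [Z + s, s]_q = Σ_{m+n=s} q^(m(m+1)/2) [Z, m]_q [Z + ⌊n/2⌋, ⌊n/2⌋]_(q²),          (∗)
-- trivial for Z < 0 (both sides vanish) and, for Z = M ≥ 0, the coefficient of x^s in
--   (-xq; q)_M · (1 + x)/(x²; q²)_(M+1) = 1/(x; q)_(M+1).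
-- This product identity is proved by induction on M from the q-Pascal recurrences of
-- the three coefficient sequences, cancelling the factor 1 - q^(M+1) x.  The identity holds for every l.

open import Defs
open import Data.Nat as ℕ using (ℕ; _≤_; _∸_; _/_)
open import Data.Integer as ℤ using (+_)
open import Relation.Binary.PropositionalEquality using (_≡_)

open import Level using (0ℓ)
open import Algebra.Bundles using (CommutativeRing; RawRing)
open import Algebra.Structures using (IsCommutativeRing)
open import Algebra.Solver.Ring.AlmostCommutativeRing
  using (AlmostCommutativeRing; _-Raw-AlmostCommutative⟶_; -raw-almostCommutative⟶;
         fromCommutativeRing; Induced-equivalence)
import Algebra.Solver.Ring as RingSolver
import Algebra.Properties.Ring
open import Data.Nat using (zero; suc; z≤n; s≤s)
import Data.Nat.Properties as ℕP
import Data.Nat.DivMod as ℕD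
import Data.Nat.Tactic.RingSolver as ℕSolver
import Data.Integer.Properties as ℤP
import Data.Integer.Tactic.RingSolver as ℤSolver
open import Data.Bool using (false)
open import Data.Bool.Properties using (T-≡)
import Data.Maybe as Maybe
open import Data.Product using (_,_)
open import Data.Sum using (inj₁; inj₂)
open import Function.Bundles using (Equivalence)
open import Relation.Binary.Definitions using (WeaklyDecidable)
open import Relation.Binary.Consequences using (dec⇒weaklyDec)
open import Relation.Nullary using (yes; no; ¬_)
open import Relation.Nullary.Decidable using (dec-true; dec-false)
import Relation.Binary.PropositionalEquality as ≡

module PowerSeries {c ℓ} (R : CommutativeRing c ℓ) where

  open CommutativeRing R hiding (zero)
  open import Algebra.Properties.CommutativeSemigroup +-commutativeSemigroup using (interchange)
  open import Algebra.Properties.Group +-group using (∙-cancelʳ)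
  open import Algebra.Properties.Ring ring using (-0#≈0#)
  open import Relation.Binary.Reasoning.Setoid setoid

  Series : Set c
  Series = ℕ → Carrier

  -- Equality of series is coefficientwise equality.  It is a record so
  -- that both sides can be recovered from its type.
  infix 4 _≋_
  record _≋_ (f g : Series) : Set ℓ where
    constructor coeffwise
    field at : ∀ n → f n ≈ g n
  open _≋_ public

  Σ : ℕ → (ℕ → Carrier) → Carrier
  Σ zero    f = f 0
  Σ (suc n) f = Σ n f + f (suc n)

  Σ-cong : ∀ n {f g : ℕ → Carrier} → (∀ i → i ≤ n → f i ≈ g i) → Σ n f ≈ Σ n g
  Σ-cong zero    f≈g = f≈g 0 z≤n
  Σ-cong (suc n) f≈g = +-cong (Σ-cong n (λ i i≤n → f≈g i (ℕP.m≤n⇒m≤1+n i≤n))) (f≈g (suc n) ℕP.≤-refl)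

  Σ-+ : ∀ n f g → Σ n (λ i → f i + g i) ≈ Σ n f + Σ n g
  Σ-+ zero    f g = refl
  Σ-+ (suc n) f g = trans (+-congʳ (Σ-+ n f g)) (interchange _ _ _ _)

  Σ-*ˡ : ∀ n a f → a * Σ n f ≈ Σ n (λ i → a * f i)
  Σ-*ˡ zero    a f = refl
  Σ-*ˡ (suc n) a f = trans (distribˡ a (Σ n f) (f (suc n))) (+-congʳ (Σ-*ˡ n a f))

  Σ-zero : ∀ n f → (∀ i → f i ≈ 0#) → Σ n f ≈ 0#
  Σ-zero zero    f f≈0 = f≈0 0
  Σ-zero (suc n) f f≈0 = trans (+-cong (Σ-zero n f f≈0) (f≈0 (suc n))) (+-identityˡ 0#)

  Σ-first : ∀ n f → Σ (suc n) f ≈ f 0 + Σ n (λ i → f (suc i))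
  Σ-first zero    f = refl
  Σ-first (suc n) f = trans (+-congʳ (Σ-first n f)) (+-assoc _ _ _)

  Σ-reverse : ∀ n f → Σ n f ≈ Σ n (λ i → f (n ∸ i))
  Σ-reverse zero    f = refl
  Σ-reverse (suc n) f = begin
    Σ n f + f (suc n)                         ≈⟨ +-congʳ (Σ-reverse n f) ⟩
    Σ n (λ i → f (n ∸ i)) + f (suc n)         ≈⟨ +-comm _ _ ⟩
    f (suc n) + Σ n (λ i → f (n ∸ i))         ≈⟨ Σ-first n (λ i → f (suc n ∸ i)) ⟨
    Σ (suc n) (λ i → f (suc n ∸ i))           ∎

  κ : Carrier → Series
  κ a zero    = a
  κ a (suc _) = 0#

  0s 1s : Series
  0s = κ 0#
  1s = κ 1#

  0s-coeff : ∀ n → 0s n ≈ 0#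
  0s-coeff zero    = refl
  0s-coeff (suc n) = refl

  tail : Series → Series
  tail f n = f (suc n)

  shift : Series → Series
  shift f zero    = 0#
  shift f (suc n) = f n

  _•_ : Carrier → Series → Series
  (a • f) n = a * f n

  -- The ring operations.  They are opaque and used only through the coefficient
  -- lemmas below, so that normalisation (e.g. by the ring solver) never unfolds them.
  infixl 6 _⊞_
  infixl 7 _⋆_
  opaque
    _⊞_ : Series → Series → Series
    (f ⊞ g) n = f n + g n

    ⊟_ : Series → Series
    (⊟ f) n = - f n

    _⋆_ : Series → Series → Series
    (f ⋆ g) n = Σ n (λ i → f i * g (n ∸ i))

    coeff-⊞ : ∀ f g n → (f ⊞ g) n ≈ f n + g n
    coeff-⊞ f g n = refl

    coeff-⊟ : ∀ f n → (⊟ f) n ≈ - f n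
    coeff-⊟ f n = refl

    coeff-⋆ : ∀ f g n → (f ⋆ g) n ≈ Σ n (λ i → f i * g (n ∸ i))
    coeff-⋆ f g n = refl

    ⋆-tail : ∀ f g n → (f ⋆ g) (suc n) ≈ f 0 * g (suc n) + (tail f ⋆ g) n
    ⋆-tail f g n = Σ-first n (λ i → f i * g (suc n ∸ i))

    ⋆-congʳ-upTo : ∀ n f {g h} → (∀ i → i ≤ n → g i ≈ h i) → (f ⋆ g) n ≈ (f ⋆ h) n
    ⋆-congʳ-upTo n f g≈h = Σ-cong n (λ i _ → *-congˡ (g≈h (n ∸ i) (ℕP.m∸n≤m n i)))

    ⋆-cong : ∀ {f f' g g'} → f ≋ f' → g ≋ g' → f ⋆ g ≋ f' ⋆ g'
    ⋆-cong f≈f' g≈g' = coeffwise λ n → Σ-cong n (λ i _ → *-cong (at f≈f' i) (at g≈g' (n ∸ i)))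

    ⋆-comm : ∀ f g → f ⋆ g ≋ g ⋆ f
    ⋆-comm f g = coeffwise λ n → trans (Σ-reverse n _) (Σ-cong n λ i i≤n →
      trans (*-comm _ _) (*-congʳ (reflexive (≡.cong g (ℕP.m∸[m∸n]≡n i≤n)))))

    ⋆-distribʳ : ∀ f g h → (f ⊞ g) ⋆ h ≋ f ⋆ h ⊞ g ⋆ h
    ⋆-distribʳ f g h = coeffwise λ n → trans (Σ-cong n (λ i _ → distribʳ _ _ _)) (Σ-+ n _ _)

    ⋆-•ˡ : ∀ a f g → (a • f) ⋆ g ≋ a • (f ⋆ g)
    ⋆-•ˡ a f g = coeffwise λ n → trans (Σ-cong n (λ i _ → *-assoc _ _ _)) (sym (Σ-*ˡ n a _))

    κ-⋆ : ∀ a f → κ a ⋆ f ≋ a • f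
    κ-⋆ a f = coeffwise λ
      { zero    → refl
      ; (suc n) → trans (Σ-first n _) (trans (+-congˡ (Σ-zero n _ (λ i → zeroˡ _))) (+-identityʳ _)) }

    shift-⋆ : ∀ f g → shift f ⋆ g ≋ shift (f ⋆ g)
    shift-⋆ f g = coeffwise λ
      { zero    → zeroˡ _
      ; (suc n) → trans (Σ-first n _) (trans (+-congʳ (zeroˡ _)) (+-identityˡ _)) }

  ⋆-identityˡ : ∀ f → 1s ⋆ f ≋ f
  ⋆-identityˡ f = coeffwise λ n → trans (at (κ-⋆ 1# f) n) (*-identityˡ (f n))

  -- Associativity, by induction on the coefficient index through ⋆-tail.
  ⋆-assoc : ∀ f g h → (f ⋆ g) ⋆ h ≋ f ⋆ (g ⋆ h)
  ⋆-assoc f g h = coeffwise (λ n → go n f)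
    where
    rearrange : ∀ a b c d e → a * b * c + (a * d + e) ≈ a * (b * c + d) + e
    rearrange a b c d e = begin
      a * b * c + (a * d + e)   ≈⟨ +-congʳ (*-assoc a b c) ⟩
      a * (b * c) + (a * d + e) ≈⟨ +-assoc _ _ _ ⟨
      a * (b * c) + a * d + e   ≈⟨ +-congʳ (distribˡ a _ _) ⟨
      a * (b * c + d) + e       ∎
    tail-⋆ : ∀ f → tail (f ⋆ g) ≋ f 0 • tail g ⊞ tail f ⋆ g
    tail-⋆ f = coeffwise λ n → trans (⋆-tail f g n) (sym (coeff-⊞ _ _ n))
    go : ∀ n f → ((f ⋆ g) ⋆ h) n ≈ (f ⋆ (g ⋆ h)) n
    go zero f = trans (coeff-⋆ _ h 0) (trans (*-congʳ (coeff-⋆ f g 0))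
                  (trans (*-assoc _ _ _) (sym (trans (coeff-⋆ f _ 0) (*-congˡ (coeff-⋆ g h 0))))))
    go (suc n) f = begin
      ((f ⋆ g) ⋆ h) (suc n)                                  ≈⟨ ⋆-tail (f ⋆ g) h n ⟩
      (f ⋆ g) 0 * h (suc n) + (tail (f ⋆ g) ⋆ h) n           ≈⟨ +-cong (*-congʳ (coeff-⋆ f g 0)) (at (⋆-cong (tail-⋆ f) (coeffwise λ _ → refl)) n) ⟩
      f 0 * g 0 * h (suc n) + ((f 0 • tail g ⊞ tail f ⋆ g) ⋆ h) n
        ≈⟨ +-congˡ (trans (at (⋆-distribʳ _ _ h) n) (coeff-⊞ _ _ n)) ⟩
      f 0 * g 0 * h (suc n) + (((f 0 • tail g) ⋆ h) n + ((tail f ⋆ g) ⋆ h) n)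
        ≈⟨ +-congˡ (+-cong (at (⋆-•ˡ (f 0) (tail g) h) n) (go n (tail f))) ⟩
      f 0 * g 0 * h (suc n) + (f 0 * (tail g ⋆ h) n + (tail f ⋆ (g ⋆ h)) n)
        ≈⟨ rearrange _ _ _ _ _ ⟩
      f 0 * (g 0 * h (suc n) + (tail g ⋆ h) n) + (tail f ⋆ (g ⋆ h)) n
        ≈⟨ +-congʳ (*-congˡ (⋆-tail g h n)) ⟨
      f 0 * (g ⋆ h) (suc n) + (tail f ⋆ (g ⋆ h)) n          ≈⟨ ⋆-tail f (g ⋆ h) n ⟨
      (f ⋆ (g ⋆ h)) (suc n)                                  ∎

  ⋆-cancelˡ : ∀ f {g h} → f 0 ≈ 1# → f ⋆ g ≋ f ⋆ h → g ≋ h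
  ⋆-cancelˡ f {g} {h} f0≈1 fg≈fh = coeffwise λ n → upTo n n ℕP.≤-refl
    where
    cancel-f0 : ∀ {a b} → f 0 * a ≈ f 0 * b → a ≈ b
    cancel-f0 {a} {b} eq = begin
      a        ≈⟨ *-identityˡ a ⟨
      1# * a   ≈⟨ *-congʳ f0≈1 ⟨
      f 0 * a  ≈⟨ eq ⟩
      f 0 * b  ≈⟨ *-congʳ f0≈1 ⟩
      1# * b   ≈⟨ *-identityˡ b ⟩
      b        ∎
    upTo : ∀ n i → i ≤ n → g i ≈ h i
    upTo zero    .zero z≤n = cancel-f0 (trans (sym (coeff-⋆ f g 0)) (trans (at fg≈fh 0) (coeff-⋆ f h 0)))
    upTo (suc n) i i≤1+n with ℕP.m≤n⇒m<n∨m≡n i≤1+n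
    ... | inj₁ (s≤s i≤n) = upTo n i i≤n
    ... | inj₂ ≡.refl = cancel-f0 (∙-cancelʳ _ _ _ (begin
      f 0 * g (suc n) + (tail f ⋆ g) n  ≈⟨ ⋆-tail f g n ⟨
      (f ⋆ g) (suc n)                   ≈⟨ at fg≈fh (suc n) ⟩
      (f ⋆ h) (suc n)                   ≈⟨ ⋆-tail f h n ⟩
      f 0 * h (suc n) + (tail f ⋆ h) n  ≈⟨ +-congˡ (⋆-congʳ-upTo n (tail f) (λ j j≤n → sym (upTo n j j≤n))) ⟩
      f 0 * h (suc n) + (tail f ⋆ g) n  ∎))

  opaque
    unfolding _⊞_ ⊟_
    series-isCommutativeRing : IsCommutativeRing _≋_ _⊞_ _⋆_ ⊟_ 0s 1s
    series-isCommutativeRing = record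
      { isRing = record
        { +-isAbelianGroup = record
          { isGroup = record
            { isMonoid = record
              { isSemigroup = record
                { isMagma = record
                  { isEquivalence = record
                    { refl  = coeffwise λ _ → refl
                    ; sym   = λ p → coeffwise λ n → sym (at p n)
                    ; trans = λ p q → coeffwise λ n → trans (at p n) (at q n) }
                  ; ∙-cong = λ p q → coeffwise λ n → +-cong (at p n) (at q n) }
                ; assoc = λ f g h → coeffwise λ n → +-assoc _ _ _ }
              ; identity = (λ f → coeffwise λ n → trans (+-congʳ (0s-coeff n)) (+-identityˡ _))
                         , (λ f → coeffwise λ n → trans (+-congˡ (0s-coeff n)) (+-identityʳ _)) }
            ; inverse = (λ f → coeffwise λ n → trans (-‿inverseˡ _) (sym (0s-coeff n)))
                      , (λ f → coeffwise λ n → trans (-‿inverseʳ _) (sym (0s-coeff n)))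
            ; ⁻¹-cong = λ p → coeffwise λ n → -‿cong (at p n) }
          ; comm = λ f g → coeffwise λ n → +-comm _ _ }
        ; *-cong = ⋆-cong
        ; *-assoc = ⋆-assoc
        ; *-identity = ⋆-identityˡ , (λ f → coeffwise λ n → trans (at (⋆-comm f 1s) n) (at (⋆-identityˡ f) n))
        ; distrib = (λ f g h → coeffwise λ n → trans (at (⋆-comm f (g ⊞ h)) n)
                                  (trans (at (⋆-distribʳ g h f) n) (+-cong (at (⋆-comm g f) n) (at (⋆-comm h f) n))))
                  , (λ h f g → ⋆-distribʳ f g h)
        }
      ; *-comm = ⋆-comm
      }

  SeriesRing : CommutativeRing c ℓ
  SeriesRing = record { isCommutativeRing = series-isCommutativeRing }

  private module S = CommutativeRing SeriesRing

  κ-cong : ∀ {a b} → a ≈ b → κ a ≋ κ b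
  κ-cong a≈b = coeffwise λ { zero → a≈b ; (suc _) → refl }

  κ-+ : ∀ a b → κ (a + b) ≋ κ a ⊞ κ b
  κ-+ a b = coeffwise λ
    { zero    → sym (coeff-⊞ _ _ 0)
    ; (suc n) → sym (trans (coeff-⊞ _ _ (suc n)) (+-identityˡ 0#)) }

  κ-* : ∀ a b → κ (a * b) ≋ κ a ⋆ κ b
  κ-* a b = coeffwise λ
    { zero    → sym (at (κ-⋆ a (κ b)) 0)
    ; (suc n) → sym (trans (at (κ-⋆ a (κ b)) (suc n)) (zeroʳ a)) }

  κ-‿ : ∀ a → κ (- a) ≋ ⊟ κ a
  κ-‿ a = coeffwise λ
    { zero    → sym (coeff-⊟ _ 0)
    ; (suc n) → sym (trans (coeff-⊟ _ (suc n)) -0#≈0#) }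

  -- A coefficient morphism into R extends, through the constants, to one into
  -- R[[x]]; this is what lets the ring solver work in R[[x]].
  module _ {c₁ ℓ₁} {Coeff : RawRing c₁ ℓ₁}
           (φ : Coeff -Raw-AlmostCommutative⟶ fromCommutativeRing R) where
    open _-Raw-AlmostCommutative⟶_ φ

    constants : Coeff -Raw-AlmostCommutative⟶ fromCommutativeRing SeriesRing
    constants = record
      { ⟦_⟧    = λ a → κ ⟦ a ⟧
      ; +-homo = λ a b → S.trans (κ-cong (+-homo a b)) (κ-+ _ _)
      ; *-homo = λ a b → S.trans (κ-cong (*-homo a b)) (κ-* _ _)
      ; -‿homo = λ a → S.trans (κ-cong (-‿homo a)) (κ-‿ _)
      ; 0-homo = κ-cong 0-homo
      ; 1-homo = κ-cong 1-homo
      }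

    constants-dec : WeaklyDecidable (Induced-equivalence φ) →
                    WeaklyDecidable (Induced-equivalence constants)
    constants-dec dec a b = Maybe.map κ-cong (dec a b)

  private module SP = Algebra.Properties.Ring S.ring

  [1+y]⋆f : ∀ y f → (1s ⊞ y) ⋆ f ≋ f ⊞ y ⋆ f
  [1+y]⋆f y f = S.trans (S.distribʳ f 1s y) (S.+-congʳ (⋆-identityˡ f))

  [1-y]⋆f : ∀ y f → (1s S.- y) ⋆ f ≋ f S.- y ⋆ f
  [1-y]⋆f y f = S.trans (S.distribʳ f 1s (⊟ y)) (S.+-cong (⋆-identityˡ f) (S.sym (SP.-‿distribˡ-* y f)))

  coeff-− : ∀ f g n → (f S.- g) n ≈ f n - g n
  coeff-− f g n = trans (coeff-⊞ f (⊟ g) n) (+-congˡ (coeff-⊟ g n))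

  shift-cong : ∀ {f g} → f ≋ g → shift f ≋ shift g
  shift-cong f≈g = coeffwise λ { zero → refl ; (suc n) → at f≈g n }

  cx-⋆ : ∀ a f → shift (κ a) ⋆ f ≋ shift (a • f)
  cx-⋆ a f = S.trans (shift-⋆ (κ a) f) (shift-cong (κ-⋆ a f))


module Q = PowerSeries ℤP.+-*-commutativeRing
open Q using (_≋_; coeffwise; at; _⊞_; ⊟_; _⋆_; 0s; 1s; shift)
module QR = CommutativeRing Q.SeriesRing

ℤ-ring : AlmostCommutativeRing 0ℓ 0ℓ
ℤ-ring = fromCommutativeRing ℤP.+-*-commutativeRing

ℤ-coefficients : AlmostCommutativeRing.rawRing ℤ-ring -Raw-AlmostCommutative⟶ ℤ-ring
ℤ-coefficients = -raw-almostCommutative⟶ ℤ-ring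

q-coefficients : AlmostCommutativeRing.rawRing ℤ-ring -Raw-AlmostCommutative⟶ fromCommutativeRing Q.SeriesRing
q-coefficients = Q.constants ℤ-coefficients

q-coefficients-dec : WeaklyDecidable (Induced-equivalence q-coefficients)
q-coefficients-dec = Q.constants-dec ℤ-coefficients (dec⇒weaklyDec ℤ._≟_)

module QSolver = RingSolver _ (fromCommutativeRing Q.SeriesRing) q-coefficients q-coefficients-dec
open QSolver using (solve; _:=_; _:+_; _:*_; :-_; _:-_; con)

minus-zero : ∀ f → f QR.- 0s ≋ f
minus-zero = solve 1 (λ f → f :- con (+ 0) := f) QR.refl

sumTo≡Σ : ∀ n f → sumTo n f ≡ Q.Σ n f
sumTo≡Σ zero    f = ≡.refl
sumTo≡Σ (suc n) f = ≡.cong (ℤ._+ f (suc n)) (sumTo≡Σ n f)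

·-is-⋆ : ∀ f g → f · g ≋ f ⋆ g
·-is-⋆ f g = coeffwise λ n → ≡.trans (sumTo≡Σ n _) (≡.sym (Q.coeff-⋆ f g n))

-ₛ-is-minus : ∀ f g → f -ₛ g ≋ f ⊞ ⊟ g
-ₛ-is-minus f g = coeffwise λ n → ≡.sym (Q.coeff-− f g n)

oneS-is-1 : oneS ≋ 1s
oneS-is-1 = coeffwise λ { zero → ≡.refl ; (suc _) → ≡.refl }

mono-0 : mono 0 ≋ 1s
mono-0 = coeffwise λ { zero → ≡.refl ; (suc _) → ≡.refl }

mono-suc : ∀ a → mono (suc a) ≋ shift (mono a)
mono-suc a = coeffwise λ { zero → ≡.refl ; (suc _) → ≡.refl }

mono-+ : ∀ a b → mono (a ℕ.+ b) ≋ mono a ⋆ mono b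
mono-+ zero    b = QR.sym (QR.trans (QR.*-congʳ mono-0) (QR.*-identityˡ (mono b)))
mono-+ (suc a) b = QR.trans (mono-suc (a ℕ.+ b)) (QR.trans (Q.shift-cong (mono-+ a b))
  (QR.sym (QR.trans (QR.*-congʳ (mono-suc a)) (Q.shift-⋆ (mono a) (mono b)))))

mono-cong : ∀ {a b} → a ≡ b → mono a ≋ mono b
mono-cong ≡.refl = QR.refl

-- The boolean test n < n fails; it decides the last branch of invUpTo.
<ᵇ-irrefl : ∀ n → (n ℕ.<ᵇ n) ≡ false
<ᵇ-irrefl zero    = ≡.refl
<ᵇ-irrefl (suc n) = <ᵇ-irrefl n

module _ (f : PS) where

  invUpTo-stable : ∀ n i → i ≤ n → invUpTo f n i ≡ inv1 f i
  invUpTo-stable zero    .zero z≤n = ≡.refl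
  invUpTo-stable (suc n) i i≤1+n with ℕP.m≤n⇒m<n∨m≡n i≤1+n
  ... | inj₂ ≡.refl = ≡.refl
  ... | inj₁ (s≤s i≤n) rewrite Equivalence.to T-≡ (ℕP.≤⇒≤ᵇ i≤n) = invUpTo-stable n i i≤n

  inv1-suc : ∀ n → inv1 f (suc n) ≡ ℤ.- Q.Σ n (λ t → f (suc n ∸ t) ℤ.* inv1 f t)
  inv1-suc n rewrite <ᵇ-irrefl n = ≡.cong ℤ.-_ (≡.trans (sumTo≡Σ n _)
    (Q.Σ-cong n (λ t t≤n → ≡.cong (f (suc n ∸ t) ℤ.*_) (invUpTo-stable n t t≤n))))

  inv1-inverse : f 0 ≡ + 1 → f ⋆ inv1 f ≋ 1s
  inv1-inverse f0≡1 = QR.trans (Q.⋆-comm f (inv1 f)) (coeffwise coefficient)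
    where
    coefficient : ∀ n → (inv1 f ⋆ f) n ≡ 1s n
    coefficient zero    rewrite Q.coeff-⋆ (inv1 f) f 0 | f0≡1 = ≡.refl
    coefficient (suc n) = begin
      (inv1 f ⋆ f) (suc n)                                 ≡⟨ Q.coeff-⋆ (inv1 f) f (suc n) ⟩
      S ℤ.+ inv1 f (suc n) ℤ.* f (suc n ∸ suc n)           ≡⟨ ≡.cong₂ (λ a b → S ℤ.+ a ℤ.* f b) (inv1-suc n) (ℕP.n∸n≡0 n) ⟩
      S ℤ.+ ℤ.- S' ℤ.* f 0                                 ≡⟨ ≡.cong (λ a → S ℤ.+ ℤ.- S' ℤ.* a) f0≡1 ⟩
      S ℤ.+ ℤ.- S' ℤ.* + 1                                 ≡⟨ ≡.cong (λ a → S ℤ.+ a) (ℤP.*-identityʳ (ℤ.- S')) ⟩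
      S ℤ.+ ℤ.- S'                                         ≡⟨ ≡.cong (λ a → S ℤ.+ ℤ.- a) S'≡S ⟩
      S ℤ.+ ℤ.- S                                          ≡⟨ ℤP.+-inverseʳ S ⟩
      + 0                                                  ∎
      where
      open ≡.≡-Reasoning
      S S' : ℤ.ℤ
      S  = Q.Σ n (λ i → inv1 f i ℤ.* f (suc n ∸ i))
      S' = Q.Σ n (λ t → f (suc n ∸ t) ℤ.* inv1 f t)
      S'≡S : S' ≡ S
      S'≡S = Q.Σ-cong n (λ i _ → ℤP.*-comm (f (suc n ∸ i)) (inv1 f i))

poch-suc : ∀ e j → poch e (suc j) ≋ poch e j ⋆ (1s QR.- mono (e ℕ.* suc j))
poch-suc e j = QR.trans (·-is-⋆ _ _)
  (QR.*-congˡ (QR.trans (-ₛ-is-minus oneS _) (QR.+-congʳ oneS-is-1)))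

poch-cong : ∀ e {a b} → a ≡ b → poch e a ≋ poch e b
poch-cong e ≡.refl = QR.refl

poch-constant : ∀ e j → poch (suc e) j 0 ≡ + 1
poch-constant e zero    = ≡.refl
poch-constant e (suc j) rewrite poch-constant e j = ≡.refl

gauss : ℕ → ℕ → ℕ → PS
gauss e A       zero    = 1s
gauss e zero    (suc B) = 0s
gauss e (suc A) (suc B) = gauss e A (suc B) ⊞ mono (e ℕ.* (A ∸ B)) ⋆ gauss e A B

gauss-above : ∀ e A B → A ℕ.< B → gauss e A B ≋ 0s
gauss-above e zero    (suc B) _         = QR.refl
gauss-above e (suc A) (suc B) (s≤s A<B) = begin
  gauss e A (suc B) ⊞ m ⋆ gauss e A B  ≈⟨ QR.+-cong (gauss-above e A (suc B) (ℕP.m≤n⇒m≤1+n A<B))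
                                                      (QR.*-congˡ (gauss-above e A B A<B)) ⟩
  0s ⊞ m ⋆ 0s                          ≈⟨ solve 1 (λ m → con (+ 0) :+ m :* con (+ 0) := con (+ 0)) QR.refl m ⟩
  0s                                   ∎
  where
  open import Relation.Binary.Reasoning.Setoid QR.setoid
  m : PS
  m = mono (e ℕ.* (A ∸ B))

gauss-diagonal : ∀ e A → gauss e A A ≋ 1s
gauss-diagonal e zero    = QR.refl
gauss-diagonal e (suc A) = begin
  gauss e A (suc A) ⊞ mono (e ℕ.* (A ∸ A)) ⋆ gauss e A A
    ≈⟨ QR.+-cong (gauss-above e A (suc A) ℕP.≤-refl) (QR.*-cong (mono-cong exponent) (gauss-diagonal e A)) ⟩
  0s ⊞ mono 0 ⋆ 1s  ≈⟨ QR.+-congˡ (QR.*-congʳ mono-0) ⟩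
  0s ⊞ 1s ⋆ 1s      ≈⟨ solve 0 (con (+ 0) :+ con (+ 1) :* con (+ 1) := con (+ 1)) QR.refl ⟩
  1s                ∎
  where
  open import Relation.Binary.Reasoning.Setoid QR.setoid
  exponent : e ℕ.* (A ∸ A) ≡ 0
  exponent = ≡.trans (≡.cong (e ℕ.*_) (ℕP.n∸n≡0 A)) (ℕP.*-zeroʳ e)

gauss-product : ∀ e A B → B ≤ A → gauss e A B ⋆ poch e B ⋆ poch e (A ∸ B) ≋ poch e A
gauss-product e A       zero    _ = QR.trans (QR.*-congʳ (QR.*-congˡ oneS-is-1))
  (solve 1 (λ P → con (+ 1) :* con (+ 1) :* P := P) QR.refl (poch e A))
gauss-product e (suc A) (suc B) (s≤s B≤A) = begin
  (gauss e A (suc B) ⊞ m₁ ⋆ gauss e A B) ⋆ poch e (suc B) ⋆ poch e (A ∸ B)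
    ≈⟨ solve 5 (λ g₁ m₁ g₀ P Q → (g₁ :+ m₁ :* g₀) :* P :* Q := g₁ :* P :* Q :+ m₁ :* (g₀ :* P :* Q))
               QR.refl (gauss e A (suc B)) m₁ (gauss e A B) (poch e (suc B)) (poch e (A ∸ B)) ⟩
  gauss e A (suc B) ⋆ poch e (suc B) ⋆ poch e (A ∸ B) ⊞ m₁ ⋆ (gauss e A B ⋆ poch e (suc B) ⋆ poch e (A ∸ B))
    ≈⟨ QR.+-cong first-term (QR.*-congˡ second-term) ⟩
  poch e A ⋆ (1s QR.- m₁) ⊞ m₁ ⋆ (poch e A ⋆ (1s QR.- m₂))
    ≈⟨ solve 3 (λ P m₁ m₂ → P :* (con (+ 1) :- m₁) :+ m₁ :* (P :* (con (+ 1) :- m₂))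
                          := P :* (con (+ 1) :- m₁ :* m₂)) QR.refl (poch e A) m₁ m₂ ⟩
  poch e A ⋆ (1s QR.- m₁ ⋆ m₂)
    ≈⟨ QR.*-congˡ (QR.+-congˡ (QR.-‿cong (QR.sym (QR.trans (mono-cong exponent) (mono-+ _ _))))) ⟩
  poch e A ⋆ (1s QR.- mono (e ℕ.* suc A))  ≈⟨ poch-suc e A ⟨
  poch e (suc A)                            ∎
  where
  open import Relation.Binary.Reasoning.Setoid QR.setoid
  m₁ m₂ : PS
  m₁ = mono (e ℕ.* (A ∸ B))
  m₂ = mono (e ℕ.* suc B)
  exponent : e ℕ.* suc A ≡ e ℕ.* (A ∸ B) ℕ.+ e ℕ.* suc B
  exponent = ≡.trans (≡.cong (e ℕ.*_) (≡.sym (≡.trans (ℕP.+-suc (A ∸ B) B) (≡.cong suc (ℕP.m∸n+n≡m B≤A)))))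
                     (ℕP.*-distribˡ-+ e (A ∸ B) (suc B))
  second-term : gauss e A B ⋆ poch e (suc B) ⋆ poch e (A ∸ B) ≋ poch e A ⋆ (1s QR.- m₂)
  second-term = begin
    gauss e A B ⋆ poch e (suc B) ⋆ poch e (A ∸ B)               ≈⟨ QR.*-congʳ (QR.*-congˡ (poch-suc e B)) ⟩
    gauss e A B ⋆ (poch e B ⋆ (1s QR.- m₂)) ⋆ poch e (A ∸ B)
      ≈⟨ solve 4 (λ g P m Q → g :* (P :* (con (+ 1) :- m)) :* Q := g :* P :* Q :* (con (+ 1) :- m))
                 QR.refl (gauss e A B) (poch e B) m₂ (poch e (A ∸ B)) ⟩
    gauss e A B ⋆ poch e B ⋆ poch e (A ∸ B) ⋆ (1s QR.- m₂)      ≈⟨ QR.*-congʳ (gauss-product e A B B≤A) ⟩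
    poch e A ⋆ (1s QR.- m₂)                                     ∎
  -- [A, B+1] (p;p)_(B+1) (p;p)_(A-B) = (p;p)_A (1 - p^(A-B)); both sides vanish when B = A.
  first-term : gauss e A (suc B) ⋆ poch e (suc B) ⋆ poch e (A ∸ B) ≋ poch e A ⋆ (1s QR.- m₁)
  first-term with ℕP.m≤n⇒m<n∨m≡n B≤A
  ... | inj₁ B<A = begin
    gauss e A (suc B) ⋆ poch e (suc B) ⋆ poch e (A ∸ B)
      ≈⟨ QR.*-congˡ (QR.trans (poch-cong e A∸B≡1+k) (poch-suc e (A ∸ suc B))) ⟩
    gauss e A (suc B) ⋆ poch e (suc B) ⋆ (poch e (A ∸ suc B) ⋆ (1s QR.- mono (e ℕ.* suc (A ∸ suc B))))
      ≈⟨ QR.*-congˡ (QR.*-congˡ (QR.+-congˡ (QR.-‿cong (mono-cong (≡.cong (e ℕ.*_) (≡.sym A∸B≡1+k)))))) ⟩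
    gauss e A (suc B) ⋆ poch e (suc B) ⋆ (poch e (A ∸ suc B) ⋆ (1s QR.- m₁))
      ≈⟨ QR.sym (QR.*-assoc _ _ _) ⟩
    gauss e A (suc B) ⋆ poch e (suc B) ⋆ poch e (A ∸ suc B) ⋆ (1s QR.- m₁)
      ≈⟨ QR.*-congʳ (gauss-product e A (suc B) B<A) ⟩
    poch e A ⋆ (1s QR.- m₁)  ∎
    where
    A∸B≡1+k : A ∸ B ≡ suc (A ∸ suc B)
    A∸B≡1+k = ℕP.+-∸-assoc 1 B<A
  ... | inj₂ ≡.refl = begin
    gauss e B (suc B) ⋆ poch e (suc B) ⋆ poch e (B ∸ B)  ≈⟨ QR.*-congʳ (QR.*-congʳ (gauss-above e B (suc B) ℕP.≤-refl)) ⟩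
    0s ⋆ poch e (suc B) ⋆ poch e (B ∸ B)
      ≈⟨ solve 3 (λ P Q R → con (+ 0) :* P :* Q := R :* (con (+ 1) :- con (+ 1))) QR.refl _ _ (poch e B) ⟩
    poch e B ⋆ (1s QR.- 1s)      ≈⟨ QR.*-congˡ (QR.+-congˡ (QR.-‿cong (QR.sym (QR.trans (mono-cong exponent₀) mono-0)))) ⟩
    poch e B ⋆ (1s QR.- m₁)      ∎
    where
    exponent₀ : e ℕ.* (B ∸ B) ≡ 0
    exponent₀ = ≡.trans (≡.cong (e ℕ.*_) (ℕP.n∸n≡0 B)) (ℕP.*-zeroʳ e)

qbin-vanish : ∀ e A B → ¬ (+ B ℤ.≤ A) → qbin e A B ≋ 0s
qbin-vanish e A B B≰A rewrite dec-false (+ B ℤ.≤? A) B≰A = coeffwise λ n → ≡.sym (Q.0s-coeff n)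

qbin-gauss : ∀ e A B → qbin (suc e) (+ A) B ≋ gauss (suc e) A B
qbin-gauss e A B with B ℕP.≤? A
... | no B≰A = QR.trans (qbin-vanish (suc e) (+ A) B (λ { (ℤ.+≤+ B≤A) → B≰A B≤A }))
                        (QR.sym (gauss-above (suc e) A B (ℕP.≰⇒> B≰A)))
... | yes B≤A rewrite dec-true (+ B ℤ.≤? + A) (ℤ.+≤+ B≤A) = begin
  poch (suc e) A · I₁ · I₂                ≈⟨ QR.trans (·-is-⋆ _ _) (QR.*-congʳ (·-is-⋆ _ _)) ⟩
  poch (suc e) A ⋆ I₁ ⋆ I₂                ≈⟨ QR.*-congʳ (QR.*-congʳ (QR.sym (gauss-product (suc e) A B B≤A))) ⟩
  G ⋆ P₁ ⋆ P₂ ⋆ I₁ ⋆ I₂                   ≈⟨ solve 5 (λ G P₁ P₂ I₁ I₂ → G :* P₁ :* P₂ :* I₁ :* I₂ := G :* (P₁ :* I₁) :* (P₂ :* I₂))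
                                                    QR.refl G P₁ P₂ I₁ I₂ ⟩
  G ⋆ (P₁ ⋆ I₁) ⋆ (P₂ ⋆ I₂)               ≈⟨ QR.*-cong (QR.*-congˡ (inv1-inverse P₁ (poch-constant e B)))
                                                     (inv1-inverse P₂ (poch-constant e (A ∸ B))) ⟩
  G ⋆ 1s ⋆ 1s                             ≈⟨ solve 1 (λ G → G :* con (+ 1) :* con (+ 1) := G) QR.refl G ⟩
  G                                       ∎
  where
  open import Relation.Binary.Reasoning.Setoid QR.setoid
  G P₁ P₂ I₁ I₂ : PS
  G  = gauss (suc e) A B
  P₁ = poch (suc e) B
  P₂ = poch (suc e) (A ∸ B)
  I₁ = inv1 P₁
  I₂ = inv1 P₂

gauss-pascal⁻ : ∀ e M j → gauss e (suc M ℕ.+ suc j) (suc j) QR.- mono (e ℕ.* suc M) ⋆ gauss e (suc M ℕ.+ j) j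
                          ≋ gauss e (M ℕ.+ suc j) (suc j)
gauss-pascal⁻ e M j = begin
  G₁ ⊞ mono (e ℕ.* ((M ℕ.+ suc j) ∸ j)) ⋆ gauss e (M ℕ.+ suc j) j QR.- c ⋆ G₀
    ≈⟨ QR.+-congʳ (QR.+-congˡ (QR.*-cong (mono-cong (≡.cong (e ℕ.*_) M+1+j∸j)) (gauss-cong (ℕP.+-suc M j)))) ⟩
  G₁ ⊞ c ⋆ G₀ QR.- c ⋆ G₀  ≈⟨ solve 3 (λ G₁ c G₀ → G₁ :+ c :* G₀ :- c :* G₀ := G₁) QR.refl G₁ c G₀ ⟩
  G₁                       ∎
  where
  open import Relation.Binary.Reasoning.Setoid QR.setoid
  G₁ G₀ c : PS
  G₁ = gauss e (M ℕ.+ suc j) (suc j)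
  G₀ = gauss e (suc M ℕ.+ j) j
  c  = mono (e ℕ.* suc M)
  M+1+j∸j : (M ℕ.+ suc j) ∸ j ≡ suc M
  M+1+j∸j = ≡.trans (≡.cong (_∸ j) (ℕP.+-suc M j)) (ℕP.m+n∸n≡m (suc M) j)
  gauss-cong : ∀ {A A'} → A ≡ A' → gauss e A j ≋ gauss e A' j
  gauss-cong ≡.refl = QR.refl

choose2 : ℕ → ℕ
choose2 zero    = 0
choose2 (suc n) = choose2 n ℕ.+ n

halve-+2 : ∀ k → (2 ℕ.+ k) / 2 ≡ suc (k / 2)
halve-+2 k = ℕD.m/n≡1+[m∸n]/n {2 ℕ.+ k} {2} (s≤s (s≤s z≤n))

module X = PowerSeries Q.SeriesRing
module XR = CommutativeRing X.SeriesRing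

module XSolver = RingSolver _ (fromCommutativeRing X.SeriesRing) (X.constants q-coefficients)
                              (X.constants-dec q-coefficients q-coefficients-dec)

cx cx² : PS → PS2
cx  c = X.shift (X.κ c)
cx² c = X.shift (cx c)

cx²-⋆ : ∀ c f → cx² c X.⋆ f X.≋ X.shift (X.shift (c X.• f))
cx²-⋆ c f = XR.trans (X.shift-⋆ (cx c) f) (X.shift-cong (X.cx-⋆ c f))

difference-of-squares : ∀ c → (X.1s X.⊞ cx c) X.⋆ (X.1s XR.- cx c) X.≋ X.1s XR.- cx² (c ⋆ c)
difference-of-squares c = XR.trans
  (XSolver.solve 1 (λ y → (XSolver.con (+ 1) XSolver.:+ y) XSolver.:* (XSolver.con (+ 1) XSolver.:- y)
                          XSolver.:= XSolver.con (+ 1) XSolver.:- y XSolver.:* y) XR.refl (cx c))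
  (XR.+-congˡ (XR.-‿cong (XR.trans (X.cx-⋆ c (cx c)) (X.shift-cong (X.coeffwise λ
    { zero          → QR.zeroʳ c
    ; (suc zero)    → QR.refl
    ; (suc (suc n)) → QR.zeroʳ c })))))

-- The three series of the generating-function identity, indexed by M:
--   (-xq; q)_M          = Σ_m q^(m(m+1)/2) [M, m]_q x^m,
--   (1 + x)/(x²; q²)_(M+1) = Σ_n [M + ⌊n/2⌋, ⌊n/2⌋]_(q²) x^n,
--   1/(x; q)_(M+1)       = Σ_s [M + s, s]_q x^s.
negPoch evenSeries invPoch : ℕ → PS2
negPoch    M m = mono (choose2 (suc m)) ⋆ gauss 1 M m
evenSeries M n = gauss 2 (M ℕ.+ n / 2) (n / 2)
invPoch    M s = gauss 1 (M ℕ.+ s) s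

negPoch-suc : ∀ M → negPoch (suc M) X.≋ (X.1s X.⊞ cx (mono (suc M))) X.⋆ negPoch M
negPoch-suc M = XR.sym (XR.trans (X.[1+y]⋆f _ _) (XR.trans (XR.+-congˡ (X.cx-⋆ c (negPoch M))) (X.coeffwise coefficient)))
  where
  open import Relation.Binary.Reasoning.Setoid QR.setoid
  c : PS
  c = mono (suc M)
  shifted-term : ∀ m → mono (choose2 (2 ℕ.+ m)) ⋆ (mono (1 ℕ.* (M ∸ m)) ⋆ gauss 1 M m) ≋ c ⋆ negPoch M m
  shifted-term m with m ℕP.≤? M
  ... | no m≰M = begin
    mono _ ⋆ (mono _ ⋆ gauss 1 M m)       ≈⟨ QR.*-congˡ (QR.*-congˡ G≈0) ⟩
    mono _ ⋆ (mono _ ⋆ 0s)                ≈⟨ solve 4 (λ a b c d → a :* (b :* con (+ 0)) := c :* (d :* con (+ 0))) QR.refl _ _ c _ ⟩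
    c ⋆ (mono (choose2 (suc m)) ⋆ 0s)     ≈⟨ QR.*-congˡ (QR.*-congˡ G≈0) ⟨
    c ⋆ negPoch M m                       ∎
    where
    G≈0 : gauss 1 M m ≋ 0s
    G≈0 = gauss-above 1 M m (ℕP.≰⇒> m≰M)
  ... | yes m≤M = begin
    mono (choose2 (2 ℕ.+ m)) ⋆ (mono (1 ℕ.* (M ∸ m)) ⋆ gauss 1 M m)  ≈⟨ QR.*-assoc _ _ _ ⟨
    mono (choose2 (2 ℕ.+ m)) ⋆ mono (1 ℕ.* (M ∸ m)) ⋆ gauss 1 M m
      ≈⟨ QR.*-congʳ (QR.trans (QR.sym (mono-+ _ _)) (QR.trans (mono-cong exponent) (mono-+ _ _))) ⟩
    c ⋆ mono (choose2 (suc m)) ⋆ gauss 1 M m                         ≈⟨ QR.*-assoc _ _ _ ⟩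
    c ⋆ negPoch M m                                                  ∎
    where
    exponent : choose2 (suc m) ℕ.+ suc m ℕ.+ 1 ℕ.* (M ∸ m) ≡ suc M ℕ.+ choose2 (suc m)
    exponent = ≡.trans (≡.cong (choose2 (suc m) ℕ.+ suc m ℕ.+_) (ℕP.*-identityˡ (M ∸ m)))
               (≡.trans (ℕP.+-assoc (choose2 (suc m)) (suc m) (M ∸ m))
               (≡.trans (≡.cong (λ a → choose2 (suc m) ℕ.+ suc a) (ℕP.m+[n∸m]≡n m≤M))
               (ℕP.+-comm (choose2 (suc m)) (suc M))))
  coefficient : ∀ m → (negPoch M X.⊞ X.shift (c X.• negPoch M)) m ≋ negPoch (suc M) m
  coefficient zero    = QR.trans (X.coeff-⊞ _ _ 0) (QR.+-identityʳ _)
  coefficient (suc m) = begin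
    (negPoch M X.⊞ X.shift (c X.• negPoch M)) (suc m)              ≈⟨ X.coeff-⊞ _ _ (suc m) ⟩
    negPoch M (suc m) ⊞ c ⋆ negPoch M m                            ≈⟨ QR.+-congˡ (shifted-term m) ⟨
    mono (choose2 (2 ℕ.+ m)) ⋆ gauss 1 M (suc m) ⊞ mono (choose2 (2 ℕ.+ m)) ⋆ (mono (1 ℕ.* (M ∸ m)) ⋆ gauss 1 M m)
                                                                   ≈⟨ QR.distribˡ _ _ _ ⟨
    negPoch (suc M) (suc m)                                        ∎

evenSeries-suc : ∀ M → (X.1s XR.- cx² (mono (2 ℕ.* suc M))) X.⋆ evenSeries (suc M) X.≋ evenSeries M
evenSeries-suc M = XR.trans (X.[1-y]⋆f _ _) (XR.trans (XR.+-congˡ (XR.-‿cong (cx²-⋆ c _))) (X.coeffwise coefficient))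
  where
  c : PS
  c = mono (2 ℕ.* suc M)
  -- coefficientwise this is the q²-Pascal recurrence, since ⌊(k+2)/2⌋ = ⌊k/2⌋ + 1
  pascal : ∀ n → evenSeries (suc M) n QR.- X.shift (X.shift (c X.• evenSeries (suc M))) n ≋ evenSeries M n
  pascal zero          = minus-zero _
  pascal (suc zero)    = minus-zero _
  pascal (suc (suc k)) rewrite halve-+2 k = gauss-pascal⁻ 2 M (k / 2)
  coefficient : ∀ n → (evenSeries (suc M) XR.- X.shift (X.shift (c X.• evenSeries (suc M)))) n ≋ evenSeries M n
  coefficient n = QR.trans (X.coeff-− _ _ n) (pascal n)

invPoch-suc : ∀ M → (X.1s XR.- cx (mono (suc M))) X.⋆ invPoch (suc M) X.≋ invPoch M
invPoch-suc M = XR.trans (X.[1-y]⋆f _ _) (XR.trans (XR.+-congˡ (XR.-‿cong (X.cx-⋆ c _))) (X.coeffwise coefficient))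
  where
  c : PS
  c = mono (suc M)
  -- coefficientwise this is the q-Pascal recurrence
  pascal : ∀ s → invPoch (suc M) s QR.- X.shift (c X.• invPoch (suc M)) s ≋ invPoch M s
  pascal zero    = minus-zero _
  pascal (suc i) = QR.trans (QR.+-congˡ (QR.-‿cong (QR.*-congʳ (mono-cong (≡.sym (ℕP.*-identityˡ (suc M)))))))
                            (gauss-pascal⁻ 1 M i)
  coefficient : ∀ s → (invPoch (suc M) XR.- X.shift (c X.• invPoch (suc M))) s ≋ invPoch M s
  coefficient s = QR.trans (X.coeff-− _ _ s) (pascal s)

-- The generating-function identity
--   (-xq; q)_M · (1 + x)/(x²; q²)_(M+1) = 1/(x; q)_(M+1),
-- by induction on M, cancelling the factor 1 - q^(M+1) x in the step.
generating-identity : ∀ M → negPoch M X.⋆ evenSeries M X.≋ invPoch M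
generating-identity zero = XR.trans (XR.*-congʳ negPoch-0) (XR.trans (XR.*-identityˡ _) (X.coeffwise λ n →
  QR.trans (gauss-diagonal 2 (n / 2)) (QR.sym (gauss-diagonal 1 n))))
  where
  negPoch-0 : negPoch 0 X.≋ X.1s
  negPoch-0 = X.coeffwise λ
    { zero    → QR.trans (QR.*-congʳ mono-0) (QR.*-identityˡ _)
    ; (suc m) → QR.zeroʳ _ }
generating-identity (suc M) = X.⋆-cancelˡ L (QR.trans (X.coeff-− _ _ 0) (minus-zero _)) (begin
  L X.⋆ (negPoch (suc M) X.⋆ evenSeries (suc M))   ≈⟨ XR.*-congˡ (XR.*-congʳ (negPoch-suc M)) ⟩
  L X.⋆ (L⁺ X.⋆ negPoch M X.⋆ evenSeries (suc M))
    ≈⟨ XSolver.solve 4 (λ L L⁺ a h → L XSolver.:* (L⁺ XSolver.:* a XSolver.:* h)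
                                   XSolver.:= a XSolver.:* (L⁺ XSolver.:* L XSolver.:* h))
                       XR.refl L L⁺ (negPoch M) (evenSeries (suc M)) ⟩
  negPoch M X.⋆ (L⁺ X.⋆ L X.⋆ evenSeries (suc M))  ≈⟨ XR.*-congˡ (XR.*-congʳ (difference-of-squares c)) ⟩
  negPoch M X.⋆ ((X.1s XR.- cx² (c ⋆ c)) X.⋆ evenSeries (suc M))
    ≈⟨ XR.*-congˡ (XR.*-congʳ (XR.+-congˡ (XR.-‿cong (X.shift-cong (X.shift-cong (X.κ-cong c²)))))) ⟩
  negPoch M X.⋆ ((X.1s XR.- cx² (mono (2 ℕ.* suc M))) X.⋆ evenSeries (suc M))
                                                    ≈⟨ XR.*-congˡ (evenSeries-suc M) ⟩
  negPoch M X.⋆ evenSeries M                        ≈⟨ generating-identity M ⟩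
  invPoch M                                         ≈⟨ invPoch-suc M ⟨
  L X.⋆ invPoch (suc M)                             ∎)
  where
  open import Relation.Binary.Reasoning.Setoid XR.setoid
  c : PS
  c  = mono (suc M)
  L L⁺ : PS2
  L  = X.1s XR.- cx c
  L⁺ = X.1s X.⊞ cx c
  c² : c ⋆ c ≋ mono (2 ℕ.* suc M)
  c² = QR.trans (QR.sym (mono-+ (suc M) (suc M))) (mono-cong (≡.cong (suc M ℕ.+_) (≡.sym (ℕP.+-identityʳ (suc M)))))

-- The coefficient of x^s in the generating-function identity, extended to every
-- integer Z (for Z < 0 both sides vanish):
--   [Z + s, s]_q = Σ_{m ≤ s} q^(m(m+1)/2) [Z, m]_q [Z + ⌊(s-m)/2⌋, ⌊(s-m)/2⌋]_(q²).
convolutionTerm : ℤ.ℤ → ℕ → ℕ → PS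
convolutionTerm Z s m = mono (choose2 (suc m)) ⋆ qbin 1 Z m ⋆ qbin 2 (Z ℤ.+ + ((s ∸ m) / 2)) ((s ∸ m) / 2)

binomial-convolution : ∀ Z s → qbin 1 (Z ℤ.+ + s) s ≋ X.Σ s (convolutionTerm Z s)
binomial-convolution (+ M) s = begin
  qbin 1 (+ (M ℕ.+ s)) s                              ≈⟨ qbin-gauss 0 (M ℕ.+ s) s ⟩
  invPoch M s                                         ≈⟨ X.at (generating-identity M) s ⟨
  (negPoch M X.⋆ evenSeries M) s                      ≈⟨ X.coeff-⋆ _ _ s ⟩
  X.Σ s (λ m → negPoch M m ⋆ evenSeries M (s ∸ m))    ≈⟨ X.Σ-cong s (λ m _ → QR.sym (term m)) ⟩
  X.Σ s (convolutionTerm (+ M) s)                     ∎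
  where
  open import Relation.Binary.Reasoning.Setoid QR.setoid
  term : ∀ m → convolutionTerm (+ M) s m ≋ negPoch M m ⋆ evenSeries M (s ∸ m)
  term m = QR.*-cong (QR.*-congˡ (qbin-gauss 0 M m)) (qbin-gauss 1 (M ℕ.+ (s ∸ m) / 2) ((s ∸ m) / 2))
binomial-convolution Z@(ℤ.-[1+ j ]) s =
  QR.trans (qbin-vanish 1 (Z ℤ.+ + s) s (ℤP.<⇒≱ (ℤP.+-monoˡ-< (+ s) ℤ.-<+)))
           (QR.sym (X.Σ-zero s _ vanish))
  where
  vanish : ∀ m → convolutionTerm Z s m ≋ 0s
  vanish m = QR.trans (QR.*-congʳ (QR.*-congˡ (qbin-vanish 1 Z m (λ ()))))
                      (solve 2 (λ a b → a :* con (+ 0) :* b := con (+ 0)) QR.refl _ _)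

-- Vandermonde for pairs: a pair from m + n elements lies in the first m,
-- in the last n, or straddles them.
choose2-+ : ∀ m n → choose2 (m ℕ.+ n) ≡ choose2 m ℕ.+ choose2 n ℕ.+ m ℕ.* n
choose2-+ zero    n = ≡.sym (ℕP.+-identityʳ (choose2 n))
choose2-+ (suc m) n = ≡.trans (≡.cong (ℕ._+ (m ℕ.+ n)) (choose2-+ m n)) (regroup (choose2 m) (choose2 n) m n)
  where
  regroup : ∀ a b m n → a ℕ.+ b ℕ.+ m ℕ.* n ℕ.+ (m ℕ.+ n) ≡ a ℕ.+ m ℕ.+ b ℕ.+ (n ℕ.+ m ℕ.* n)
  regroup = ℕSolver.solve-∀

choose2-double : ∀ n → choose2 (suc n) ℕ.* 2 ≡ suc n ℕ.* n
choose2-double zero    = ≡.refl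
choose2-double (suc n) = begin
  (choose2 (suc n) ℕ.+ suc n) ℕ.* 2        ≡⟨ ℕP.*-distribʳ-+ 2 (choose2 (suc n)) (suc n) ⟩
  choose2 (suc n) ℕ.* 2 ℕ.+ suc n ℕ.* 2    ≡⟨ ≡.cong (ℕ._+ suc n ℕ.* 2) (choose2-double n) ⟩
  suc n ℕ.* n ℕ.+ suc n ℕ.* 2              ≡⟨ expand n ⟩
  suc (suc n) ℕ.* suc n                     ∎
  where
  open ≡.≡-Reasoning
  expand : ∀ n → suc n ℕ.* n ℕ.+ suc n ℕ.* 2 ≡ suc (suc n) ℕ.* suc n
  expand = ℕSolver.solve-∀

choose2-div : ∀ n → (n ℕ.* (n ∸ 1)) / 2 ≡ choose2 n
choose2-div zero    = ≡.refl
choose2-div (suc n) = ≡.trans (≡.cong (_/ 2) (≡.sym (choose2-double n))) (ℕD.m*n/n≡m (choose2 (suc n)) 2)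

triangle-div : ∀ m → (m ℕ.* (m ℕ.+ 1)) / 2 ≡ choose2 (suc m)
triangle-div m = ≡.trans (≡.cong (_/ 2) (≡.trans (ℕP.*-comm m (m ℕ.+ 1)) (≡.cong (ℕ._* m) (ℕP.+-comm m 1))))
                         (choose2-div (suc m))

lhsExponent : ℕ → ℕ → ℕ → ℕ
lhsExponent l k s = l ℕ.* s ℕ.+ k ℕ.* ((s ℕ.* (s ∸ 1)) / 2)

Qkl-split : ∀ k l m n → Qkl k l m n ≡ + (lhsExponent l k (m ℕ.+ n) ℕ.+ choose2 (suc m))
Qkl-split k l m n = begin
  Qkl k l m n
    ≡⟨ ≡.cong₂ (λ a b → + ((m ℕ.+ n) ℕ.* l) ℤ.+ + (k ℕ.* a) ℤ.+ ((+ n ℤ.- + 1) ℤ.* + m ℤ.* + k) ℤ.+ + ((k ℕ.+ 1) ℕ.* b))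
               (choose2-div n) (triangle-div m) ⟩
  + ((m ℕ.+ n) ℕ.* l) ℤ.+ + (k ℕ.* Cn) ℤ.+ ((+ n ℤ.- + 1) ℤ.* + m ℤ.* + k) ℤ.+ + ((k ℕ.+ 1) ℕ.* (Cm ℕ.+ m))
    ≡⟨ ≡.cong₂ (λ a b → a ℤ.+ ((+ n ℤ.- + 1) ℤ.* + m ℤ.* + k) ℤ.+ b)
               (≡.cong₂ ℤ._+_ (ℤP.pos-* (m ℕ.+ n) l) (ℤP.pos-* k Cn))
               (≡.trans (ℤP.pos-* (k ℕ.+ 1) (Cm ℕ.+ m)) (≡.cong₂ ℤ._*_ (ℤP.pos-+ k 1) (ℤP.pos-+ Cm m))) ⟩
  (+ m ℤ.+ + n) ℤ.* + l ℤ.+ + k ℤ.* + Cn ℤ.+ (+ n ℤ.- + 1) ℤ.* + m ℤ.* + k ℤ.+ (+ k ℤ.+ + 1) ℤ.* (+ Cm ℤ.+ + m)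
    ≡⟨ expand (+ l) (+ k) (+ m) (+ n) (+ Cm) (+ Cn) ⟩
  + l ℤ.* (+ m ℤ.+ + n) ℤ.+ + k ℤ.* (+ Cm ℤ.+ + Cn ℤ.+ + m ℤ.* + n) ℤ.+ (+ Cm ℤ.+ + m)
    ≡⟨ ≡.cong₂ (λ a b → a ℤ.+ b ℤ.+ (+ Cm ℤ.+ + m)) l-part k-part ⟨
  + (l ℕ.* (m ℕ.+ n)) ℤ.+ + (k ℕ.* (((m ℕ.+ n) ℕ.* (m ℕ.+ n ∸ 1)) / 2)) ℤ.+ + (Cm ℕ.+ m)
    ≡⟨⟩
  + (lhsExponent l k (m ℕ.+ n) ℕ.+ choose2 (suc m))  ∎
  where
  open ≡.≡-Reasoning
  Cm Cn : ℕ
  Cm = choose2 m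
  Cn = choose2 n
  expand : ∀ l k m n Cm Cn →
    (m ℤ.+ n) ℤ.* l ℤ.+ k ℤ.* Cn ℤ.+ (n ℤ.- + 1) ℤ.* m ℤ.* k ℤ.+ (k ℤ.+ + 1) ℤ.* (Cm ℤ.+ m)
      ≡ l ℤ.* (m ℤ.+ n) ℤ.+ k ℤ.* (Cm ℤ.+ Cn ℤ.+ m ℤ.* n) ℤ.+ (Cm ℤ.+ m)
  expand = ℤSolver.solve-∀
  l-part : + (l ℕ.* (m ℕ.+ n)) ≡ + l ℤ.* (+ m ℤ.+ + n)
  l-part = ℤP.pos-* l (m ℕ.+ n)
  k-part : + (k ℕ.* (((m ℕ.+ n) ℕ.* (m ℕ.+ n ∸ 1)) / 2)) ≡ + k ℤ.* (+ Cm ℤ.+ + Cn ℤ.+ + m ℤ.* + n)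
  k-part = begin
    + (k ℕ.* (((m ℕ.+ n) ℕ.* (m ℕ.+ n ∸ 1)) / 2))  ≡⟨ ≡.cong (λ a → + (k ℕ.* a)) (≡.trans (choose2-div (m ℕ.+ n)) (choose2-+ m n)) ⟩
    + (k ℕ.* (Cm ℕ.+ Cn ℕ.+ m ℕ.* n))              ≡⟨ ℤP.pos-* k _ ⟩
    + k ℤ.* + (Cm ℕ.+ Cn ℕ.+ m ℕ.* n)              ≡⟨ ≡.cong (λ a → + k ℤ.* (+ Cm ℤ.+ + Cn ℤ.+ a)) (ℤP.pos-* m n) ⟩
    + k ℤ.* (+ Cm ℤ.+ + Cn ℤ.+ + m ℤ.* + n)        ∎

top : ℕ → ℕ → ℕ → ℕ → ℤ.ℤ
top N k l s = + N ℤ.- + l ℤ.- (+ s ℤ.- + 1) ℤ.* + k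

top-first : ∀ N k l m n →
  + N ℤ.- (+ l ℤ.+ (+ n ℤ.- + 1) ℤ.* + k ℤ.+ + m ℤ.* + (k ℕ.+ 1)) ℤ.+ + m ≡ top N k l (m ℕ.+ n)
top-first N k l m n = regroup (+ N) (+ l) (+ k) (+ m) (+ n)
  where
  regroup : ∀ N l k m n →
    N ℤ.- (l ℤ.+ (n ℤ.- + 1) ℤ.* k ℤ.+ m ℤ.* (k ℤ.+ + 1)) ℤ.+ m ≡ N ℤ.- l ℤ.- ((m ℤ.+ n) ℤ.- + 1) ℤ.* k
  regroup = ℤSolver.solve-∀

top-second : ∀ N k l m n h →
  + N ℤ.- (+ l ℤ.+ (+ n ℤ.- + 1) ℤ.* + k) ℤ.- + k ℤ.* + m ℤ.+ + h ≡ top N k l (m ℕ.+ n) ℤ.+ + h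
top-second N k l m n h = regroup (+ N) (+ l) (+ k) (+ m) (+ n) (+ h)
  where
  regroup : ∀ N l k m n h →
    N ℤ.- (l ℤ.+ (n ℤ.- + 1) ℤ.* k) ℤ.- k ℤ.* m ℤ.+ h ≡ N ℤ.- l ℤ.- ((m ℤ.+ n) ℤ.- + 1) ℤ.* k ℤ.+ h
  regroup = ℤSolver.solve-∀

rhsSummand : ℕ → ℕ → ℕ → ℕ → ℕ → PS
rhsSummand N k l m n =
  monoℤ (Qkl k l m n)
  · qbin 1 (+ N ℤ.- (+ l ℤ.+ (+ n ℤ.- + 1) ℤ.* + k ℤ.+ + m ℤ.* + (k ℕ.+ 1)) ℤ.+ + m) m
  · qbin 2 (+ N ℤ.- (+ l ℤ.+ (+ n ℤ.- + 1) ℤ.* + k) ℤ.- + k ℤ.* + m ℤ.+ + (n / 2)) (n / 2)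

rhsSummand-convolution : ∀ N k l s m → m ≤ s →
  rhsSummand N k l m (s ∸ m) ≋ mono (lhsExponent l k s) ⋆ convolutionTerm (top N k l s) s m
rhsSummand-convolution N k l s m m≤s = begin
  rhsSummand N k l m n                                  ≈⟨ QR.trans (·-is-⋆ _ _) (QR.*-congʳ (·-is-⋆ _ _)) ⟩
  monoℤ (Qkl k l m n) ⋆ B₁ ⋆ B₂
    ≈⟨ QR.*-cong (QR.*-cong exponent (QR.reflexive (≡.cong (λ Z → qbin 1 Z m) first)))
                 (QR.reflexive (≡.cong (λ Z → qbin 2 Z (n / 2)) second)) ⟩
  mono (lhsExponent l k s ℕ.+ choose2 (suc m)) ⋆ qbin 1 Z m ⋆ qbin 2 (Z ℤ.+ + (n / 2)) (n / 2)
    ≈⟨ QR.*-congʳ (QR.*-congʳ (mono-+ _ _)) ⟩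
  mono (lhsExponent l k s) ⋆ mono (choose2 (suc m)) ⋆ qbin 1 Z m ⋆ qbin 2 (Z ℤ.+ + (n / 2)) (n / 2)
    ≈⟨ solve 4 (λ a b c d → a :* b :* c :* d := a :* (b :* c :* d)) QR.refl _ _ _ _ ⟩
  mono (lhsExponent l k s) ⋆ convolutionTerm Z s m      ∎
  where
  open import Relation.Binary.Reasoning.Setoid QR.setoid
  n : ℕ
  n = s ∸ m
  Z : ℤ.ℤ
  Z = top N k l s
  m+n≡s : m ℕ.+ n ≡ s
  m+n≡s = ℕP.m+[n∸m]≡n m≤s
  B₁ B₂ : PS
  B₁ = qbin 1 (+ N ℤ.- (+ l ℤ.+ (+ n ℤ.- + 1) ℤ.* + k ℤ.+ + m ℤ.* + (k ℕ.+ 1)) ℤ.+ + m) m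
  B₂ = qbin 2 (+ N ℤ.- (+ l ℤ.+ (+ n ℤ.- + 1) ℤ.* + k) ℤ.- + k ℤ.* + m ℤ.+ + (n / 2)) (n / 2)
  exponent : monoℤ (Qkl k l m n) ≋ mono (lhsExponent l k s ℕ.+ choose2 (suc m))
  exponent = coeffwise λ d → ≡.cong (λ e → monoℤ e d)
    (≡.trans (Qkl-split k l m n) (≡.cong (λ t → + (lhsExponent l k t ℕ.+ choose2 (suc m))) m+n≡s))
  first : + N ℤ.- (+ l ℤ.+ (+ n ℤ.- + 1) ℤ.* + k ℤ.+ + m ℤ.* + (k ℕ.+ 1)) ℤ.+ + m ≡ Z
  first = ≡.trans (top-first N k l m n) (≡.cong (top N k l) m+n≡s)
  second : + N ℤ.- (+ l ℤ.+ (+ n ℤ.- + 1) ℤ.* + k) ℤ.- + k ℤ.* + m ℤ.+ + (n / 2) ≡ Z ℤ.+ + (n / 2)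
  second = ≡.trans (top-second N k l m n (n / 2)) (≡.cong (λ t → top N k l t ℤ.+ + (n / 2)) m+n≡s)

Σ-coefficient : ∀ s (F : ℕ → PS) d → X.Σ s F d ≡ sumTo s (λ m → F m d)
Σ-coefficient zero    F d = ≡.refl
Σ-coefficient (suc s) F d = ≡.trans (Q.coeff-⊞ (X.Σ s F) (F (suc s)) d) (≡.cong (ℤ._+ F (suc s) d) (Σ-coefficient s F d))

theorem2p7 : (N k l : ℕ) → 1 ≤ l → (s d : ℕ) →
    xSum (λ j → mono (l ℕ.* j ℕ.+ k ℕ.* ((j ℕ.* (j ∸ 1)) / 2))
                · qbin 1 (+ N ℤ.- + l ℤ.- (+ j ℤ.- + 1) ℤ.* + k ℤ.+ + j) j) s d
    ≡
    xSum2 (λ m n → monoℤ (Qkl k l m n)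
                   · qbin 1 (+ N ℤ.- (+ l ℤ.+ (+ n ℤ.- + 1) ℤ.* + k ℤ.+ + m ℤ.* + (k ℕ.+ 1)) ℤ.+ + m) m
                   · qbin 2 (+ N ℤ.- (+ l ℤ.+ (+ n ℤ.- + 1) ℤ.* + k) ℤ.- + k ℤ.* + m ℤ.+ + (n / 2)) (n / 2)) s d
theorem2p7 N k l _ s d = ≡.trans (at coefficients d) (Σ-coefficient s (λ m → rhsSummand N k l m (s ∸ m)) d)
  where
  open import Relation.Binary.Reasoning.Setoid QR.setoid
  coefficients : mono (lhsExponent l k s) · qbin 1 (top N k l s ℤ.+ + s) s ≋ X.Σ s (λ m → rhsSummand N k l m (s ∸ m))
  coefficients = begin
    mono (lhsExponent l k s) · qbin 1 (top N k l s ℤ.+ + s) s      ≈⟨ ·-is-⋆ _ _ ⟩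
    mono (lhsExponent l k s) ⋆ qbin 1 (top N k l s ℤ.+ + s) s      ≈⟨ QR.*-congˡ (binomial-convolution (top N k l s) s) ⟩
    mono (lhsExponent l k s) ⋆ X.Σ s (convolutionTerm (top N k l s) s)
                                                                    ≈⟨ X.Σ-*ˡ s _ _ ⟩
    X.Σ s (λ m → mono (lhsExponent l k s) ⋆ convolutionTerm (top N k l s) s m)
                                                                    ≈⟨ X.Σ-cong s (λ m m≤s → QR.sym (rhsSummand-convolution N k l s m m≤s)) ⟩
    X.Σ s (λ m → rhsSummand N k l m (s ∸ m))                        ∎
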